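{- Let $\pi$ be a permutation of a finite set $X$ and let $\tau:X\times X\to X\times X$, $(x,y)\tau=(y,x)$. Call an orbit $\Gamma$ of $\langle\pi^2\rangle$ acting on $X\times X$ by $(x,y)\pi^2=(x\pi^2,y\pi^2)$ singular if $\Gamma\pi\tau=\Gamma$. Then: for each cycle $C$ of $\pi$ of odd length there is exactly one singular orbit contained in $C\times C$, namely the diagonal $\{(x,x):x\in C\}$; for each cycle $C$ of $\pi$ of length $\equiv 2\pmod 4$ there are exactly two singular orbits contained in $C\times C$; and there are no other singular orbits.
   Context: Here $\Gamma\pi\tau=\{(y\pi,x\pi):(x,y)\in\Gamma\}$, which is again an orbit of $\langle\pi^2\rangle$. Cycles of $\pi$ are its orbits on $X$. -}

module Defs where

open import Data.Nat using (ℕ; zero; suc; _<_; _≤_; _*_)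
open import Data.Fin using (Fin)
open import Data.Fin.Permutation using (Permutation′; _⟨$⟩ʳ_)
open import Data.Product using (Σ; ∃; _×_; _,_; proj₁; proj₂)
open import Relation.Binary.PropositionalEquality using (_≡_)

-- X is the finite set Fin n; π acts on the right: x π = π ⟨$⟩ʳ x.
-- k-th power of π applied to x.
_^[_]_ : ∀ {n} → Permutation′ n → ℕ → Fin n → Fin n
π ^[ zero ] x = x
π ^[ suc k ] x = π ⟨$⟩ʳ (π ^[ k ] x)

Rel2 : ℕ → Set₁
Rel2 n = Fin n × Fin n → Set

_≐_ : ∀ {n} → Rel2 n → Rel2 n → Set
A ≐ B = ∀ p → (A p → B p) × (B p → A p)

-- the orbit of (x , y) under ⟨π²⟩ acting diagonally on X × X
-- (π has finite order, so ⟨π²⟩ = { π^(2k) : k ∈ ℕ })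
Orbit : ∀ {n} → Permutation′ n → Fin n → Fin n → Rel2 n
Orbit π x y p = ∃ λ k → (π ^[ 2 * k ] x , π ^[ 2 * k ] y) ≡ p

_πτ : ∀ {n} → Permutation′ n × Rel2 n → Rel2 n
((π , Γ) πτ) p = ∃ λ q → Γ q × (π ⟨$⟩ʳ proj₂ q , π ⟨$⟩ʳ proj₁ q) ≡ p

Singular : ∀ {n} → Permutation′ n → Rel2 n → Set
Singular π Γ = ((π , Γ) πτ) ≐ Γ

Cycle : ∀ {n} → Permutation′ n → Fin n → Fin n → Set
Cycle π c z = ∃ λ k → π ^[ k ] c ≡ z

CycleLength : ∀ {n} → Permutation′ n → Fin n → ℕ → Set
CycleLength π c L =
  0 < L × π ^[ L ] c ≡ c × (∀ k → 0 < k → π ^[ k ] c ≡ c → L ≤ k)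

_⊆Sq_ : ∀ {n} → Rel2 n → (Fin n → Set) → Set
Γ ⊆Sq C = ∀ p → Γ p → C (proj₁ p) × C (proj₂ p)

Diag : ∀ {n} → (Fin n → Set) → Rel2 n
Diag C p = C (proj₁ p) × proj₁ p ≡ proj₂ p

-- Write y = x π^d for a singular orbit Γ of (x , y). Then Γ π τ = Γ says that some π^(2k)
-- maps (x , y) to (y π , x π); comparing the two coordinates gives x π^(2d) = x and,
-- modulo the cycle length L of x, 2k ≡ d + 1. Hence L ∣ 2d, and if L is even then d is odd.
-- For odd L this forces d ≡ 0, so Γ lies on the diagonal, which π² sweeps out entirely
-- since 2 is invertible modulo L. For even L = 2M it forces M ∣ d with d/M odd, so d ≡ M
-- (mod L), M is odd and L ≡ 2 (mod 4); the orbit of (x , x π^M) then only depends on the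
-- parity of the position of x on the cycle, which gives exactly two singular orbits.
module Submission where

open import Defs
open import Level using (0ℓ)
open import Data.Nat
open import Data.Nat.Properties
open import Data.Nat.DivMod
open import Data.Nat.Divisibility
open import Data.Nat.Induction using (<-rec)
open import Data.Nat.Tactic.RingSolver using (solve-∀)
open import Data.Fin using (Fin; toℕ)
open import Data.Fin.Properties using (pigeonhole) renaming (_≟_ to _≟ᶠ_)
open import Data.Fin.Permutation using (Permutation′; _⟨$⟩ʳ_; _⟨$⟩ˡ_; inverseˡ)
open import Data.Product using (∃; _×_; _,_; proj₁; proj₂)
open import Data.Product.Properties using (,-injectiveˡ; ,-injectiveʳ)
open import Data.Sum using (_⊎_; inj₁; inj₂)
open import Relation.Nullary using (¬_; yes; no; contradiction)
open import Relation.Nullary.Decidable using (_×-dec_)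
open import Relation.Unary using (Pred; Decidable)
open import Relation.Binary.PropositionalEquality

data EvenOdd : ℕ → Set where
  even : ∀ h → EvenOdd (2 * h)
  odd  : ∀ h → EvenOdd (1 + 2 * h)

evenOdd : ∀ n → EvenOdd n
evenOdd zero = even 0
evenOdd (suc n) with evenOdd n
... | even h = odd h
... | odd h = subst EvenOdd (*-suc 2 h) (even (suc h))

2*n%2≡0 : ∀ h → 2 * h % 2 ≡ 0
2*n%2≡0 h = trans (%-congˡ {o = 2} (*-comm 2 h)) (m*n%n≡0 h 2)

[1+2*n]%2≡1 : ∀ h → (1 + 2 * h) % 2 ≡ 1
[1+2*n]%2≡1 h = trans (%-congˡ {o = 2} (cong suc (*-comm 2 h))) ([m+kn]%n≡m%n 1 h 2)

n%2≡1⇒odd : ∀ {n} → n % 2 ≡ 1 → ∃ λ h → n ≡ 1 + 2 * h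
n%2≡1⇒odd {n} n%2≡1 with evenOdd n
... | even h = contradiction (trans (sym (2*n%2≡0 h)) n%2≡1) 0≢1+n
... | odd h = h , refl

∣-odd⇒odd : ∀ {m n} → m ∣ n → n % 2 ≡ 1 → m % 2 ≡ 1
∣-odd⇒odd {m} m∣n n%2≡1 with evenOdd m
... | odd h = [1+2*n]%2≡1 h
... | even h = contradiction (trans (sym (n∣m⇒m%n≡0 _ 2 (∣-trans (m∣m*n h) m∣n))) n%2≡1) 0≢1+n

2*[1+2*n]≡2+n*4 : ∀ h → 2 * (1 + 2 * h) ≡ 2 + h * 4
2*[1+2*n]≡2+n*4 = solve-∀

n%4≡2⇒2*odd : ∀ {n} → n % 4 ≡ 2 → ∃ λ h → n ≡ 2 * (1 + 2 * h)
n%4≡2⇒2*odd {n} n%4≡2 = n / 4 , (begin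
  n                     ≡⟨ m≡m%n+[m/n]*n n 4 ⟩
  n % 4 + n / 4 * 4     ≡⟨ cong (_+ n / 4 * 4) n%4≡2 ⟩
  2 + n / 4 * 4         ≡⟨ 2*[1+2*n]≡2+n*4 (n / 4) ⟨
  2 * (1 + 2 * (n / 4)) ∎)
  where open ≡-Reasoning

2*[1+2*n]%4≡2 : ∀ h → 2 * (1 + 2 * h) % 4 ≡ 2
2*[1+2*n]%4≡2 h = trans (%-congˡ {o = 4} (2*[1+2*n]≡2+n*4 h)) ([m+kn]%n≡m%n 2 h 4)

module _ {P : Pred ℕ 0ℓ} (P? : Decidable P) where

  least-witness : ∀ {n} → P n → ∃ λ m → P m × (∀ k → P k → m ≤ k)
  least-witness {n} = <-rec Goal step n
    where
    Goal : ℕ → Set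
    Goal n = P n → ∃ λ m → P m × (∀ k → P k → m ≤ k)
    step : ∀ n → (∀ {m} → m < n → Goal m) → Goal n
    step n below Pn with anyUpTo? P? n
    ... | yes (m , m<n , Pm) = below m<n Pm
    ... | no none = n , Pn , λ k Pk → ≮⇒≥ λ k<n → none (k , k<n , Pk)

≐-trans : ∀ {n} {A B C : Rel2 n} → A ≐ B → B ≐ C → A ≐ C
≐-trans A≐B B≐C p = (λ a → proj₁ (B≐C p) (proj₁ (A≐B p) a)) ,
                     (λ c → proj₂ (A≐B p) (proj₂ (B≐C p) c))

module Cycles {n : ℕ} (π : Permutation′ n) where

  π-injective : ∀ {u v} → π ⟨$⟩ʳ u ≡ π ⟨$⟩ʳ v → u ≡ v
  π-injective eq = trans (sym (inverseˡ π)) (trans (cong (π ⟨$⟩ˡ_) eq) (inverseˡ π))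

  ^-cong : ∀ x {a b} → a ≡ b → π ^[ a ] x ≡ π ^[ b ] x
  ^-cong x = cong (λ e → π ^[ e ] x)

  ^-+ : ∀ a b x → π ^[ a + b ] x ≡ π ^[ a ] (π ^[ b ] x)
  ^-+ zero b x = refl
  ^-+ (suc a) b x = cong (π ⟨$⟩ʳ_) (^-+ a b x)

  ^-comm : ∀ a b x → π ^[ a ] (π ^[ b ] x) ≡ π ^[ b ] (π ^[ a ] x)
  ^-comm a b x = trans (sym (^-+ a b x)) (trans (^-cong x (+-comm a b)) (^-+ b a x))

  ^-injective : ∀ a {u v} → π ^[ a ] u ≡ π ^[ a ] v → u ≡ v
  ^-injective zero eq = eq
  ^-injective (suc a) eq = ^-injective a (π-injective eq)

  ^-cancel : ∀ a t x → π ^[ a + t ] x ≡ π ^[ a ] x → π ^[ t ] x ≡ x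
  ^-cancel a t x eq = ^-injective a (trans (sym (^-+ a t x)) eq)

  ^-*-fixed : ∀ {N x} → π ^[ N ] x ≡ x → ∀ q → π ^[ q * N ] x ≡ x
  ^-*-fixed per zero = refl
  ^-*-fixed {N} {x} per (suc q) =
    trans (^-+ N (q * N) x) (trans (cong (π ^[ N ]_) (^-*-fixed per q)) per)

  ^-periodic : ∀ {N x} → π ^[ N ] x ≡ x → ∀ a q → π ^[ a + q * N ] x ≡ π ^[ a ] x
  ^-periodic {N} {x} per a q = trans (^-+ a (q * N) x) (cong (π ^[ a ]_) (^-*-fixed per q))

  period-exists : ∀ x → ∃ λ e → 0 < e × π ^[ e ] x ≡ x
  period-exists x with pigeonhole (n<1+n n) (λ (i : Fin (suc n)) → π ^[ toℕ i ] x)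
  ... | i , j , i<j , eq = toℕ j ∸ toℕ i , m<n⇒0<n∸m i<j ,
    ^-cancel (toℕ i) _ x (trans (^-cong x (m+[n∸m]≡n (<⇒≤ i<j))) (sym eq))

  cycleLength-exists : ∀ x → ∃ (CycleLength π x)
  cycleLength-exists x with period-exists x
  ... | _ , pos , per with least-witness (λ k → 0 <? k ×-dec π ^[ k ] x ≟ᶠ x) (pos , per)
  ...   | L , (L>0 , L-per) , least = L , L>0 , L-per , λ k k>0 k-per → least k (k>0 , k-per)

  cycleLength-∣ : ∀ {x L e} → CycleLength π x L → π ^[ e ] x ≡ x → L ∣ e
  cycleLength-∣ {x} {L@(suc _)} {e} (_ , per , least) e-per = m%n≡0⇒n∣m e L residue≡0
    where
    residue-fixed : π ^[ e % L ] x ≡ x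
    residue-fixed = trans (sym (^-periodic per (e % L) (e / L)))
                          (trans (^-cong x (sym (m≡m%n+[m/n]*n e L))) e-per)
    residue≡0 : e % L ≡ 0
    residue≡0 with e % L | residue-fixed | m%n<n e L
    ... | zero | _ | _ = refl
    ... | suc r | r-per | r<L = contradiction (least (suc r) z<s r-per) (<⇒≱ r<L)

  ^-≡⇒%-≡-≤ : ∀ {x L m a b} .{{_ : NonZero m}} → CycleLength π x L → m ∣ L → a ≤ b →
              π ^[ b ] x ≡ π ^[ a ] x → b % m ≡ a % m
  ^-≡⇒%-≡-≤ {x} {a = a} cl m∣L a≤b eq with m≤n⇒∃[o]m+o≡n a≤b
  ... | t , refl = %-remove-+ʳ a (∣-trans m∣L (cycleLength-∣ cl (^-cancel a t x eq)))

  ^-≡⇒%-≡ : ∀ {x L m a b} .{{_ : NonZero m}} → CycleLength π x L → m ∣ L →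
            π ^[ a ] x ≡ π ^[ b ] x → a % m ≡ b % m
  ^-≡⇒%-≡ {a = a} {b} cl m∣L eq with ≤-total a b
  ... | inj₁ a≤b = sym (^-≡⇒%-≡-≤ cl m∣L a≤b (sym eq))
  ... | inj₂ b≤a = ^-≡⇒%-≡-≤ cl m∣L b≤a eq

  Cycle-^ : ∀ {c x} → Cycle π c x → ∀ a → Cycle π c (π ^[ a ] x)
  Cycle-^ {c} (i , refl) a = a + i , ^-+ a i c

  Cycle-periodic : ∀ {N c x} → π ^[ N ] c ≡ c → Cycle π c x → π ^[ N ] x ≡ x
  Cycle-periodic {N} {c} per (i , refl) = trans (^-comm N i c) (cong (π ^[ i ]_) per)

  Cycle-reach : ∀ {N c x z} → π ^[ suc N ] c ≡ c → Cycle π c x → Cycle π c z → Cycle π x z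
  Cycle-reach {N} {c} per (i , refl) (t , refl) = t + N * i , (begin
    π ^[ t + N * i ] (π ^[ i ] c) ≡⟨ ^-+ (t + N * i) i c ⟨
    π ^[ t + N * i + i ] c        ≡⟨ ^-cong c (exponent t N i) ⟩
    π ^[ t + i * suc N ] c        ≡⟨ ^-periodic per t i ⟩
    π ^[ t ] c                    ∎)
    where
    open ≡-Reasoning
    exponent : ∀ t N i → t + N * i + i ≡ t + i * suc N
    exponent = solve-∀

  CycleLength-member : ∀ {c x L} → CycleLength π c L → Cycle π c x → CycleLength π x L
  CycleLength-member {c} {L = L} (L>0 , per , least) x∈C@(i , refl) =
    L>0 , Cycle-periodic {L} per x∈C ,
    λ k k>0 k-per → least k k>0 (^-injective i (trans (^-comm i k c) k-per))

  Orbit-⊆Sq : ∀ {c x y} → Cycle π c x → Cycle π c y → Orbit π x y ⊆Sq Cycle π c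
  Orbit-⊆Sq x∈C y∈C _ (k , refl) = Cycle-^ x∈C (2 * k) , Cycle-^ y∈C (2 * k)

  ^-2*-+ : ∀ a b x → π ^[ 2 * (a + b) ] x ≡ π ^[ 2 * a ] (π ^[ 2 * b ] x)
  ^-2*-+ a b x = trans (^-cong x (*-distribˡ-+ 2 a b)) (^-+ (2 * a) (2 * b) x)

  ^-even-inverse : ∀ {N x} → π ^[ suc N ] x ≡ x → ∀ k → π ^[ 2 * (k * N) ] (π ^[ 2 * k ] x) ≡ x
  ^-even-inverse {N} {x} per k = begin
    π ^[ 2 * (k * N) ] (π ^[ 2 * k ] x) ≡⟨ ^-2*-+ (k * N) k x ⟨
    π ^[ 2 * (k * N + k) ] x            ≡⟨ ^-cong x (exponent k N) ⟩
    π ^[ 2 * k * suc N ] x              ≡⟨ ^-*-fixed per (2 * k) ⟩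
    x                                   ∎
    where
    open ≡-Reasoning
    exponent : ∀ k N → 2 * (k * N + k) ≡ 2 * k * suc N
    exponent = solve-∀

  Orbit-member : ∀ {N x y u v} → π ^[ suc N ] x ≡ x → π ^[ suc N ] y ≡ y →
                 Orbit π x y (u , v) → Orbit π u v ≐ Orbit π x y
  Orbit-member {N} {x} {y} x-per y-per (k , refl) p = into , back
    where
    into : Orbit π (π ^[ 2 * k ] x) (π ^[ 2 * k ] y) p → Orbit π x y p
    into (j , refl) = j + k , cong₂ _,_ (^-2*-+ j k x) (^-2*-+ j k y)
    back : Orbit π x y p → Orbit π (π ^[ 2 * k ] x) (π ^[ 2 * k ] y) p
    back (j , refl) = j + k * N , cong₂ _,_ (undo x-per) (undo y-per)
      where
      undo : ∀ {z} → π ^[ suc N ] z ≡ z → π ^[ 2 * (j + k * N) ] (π ^[ 2 * k ] z) ≡ π ^[ 2 * j ] z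
      undo {z} z-per = trans (^-2*-+ j (k * N) _) (cong (π ^[ 2 * j ]_) (^-even-inverse z-per k))

  πτ-Orbit : ∀ {x y} → ((π , Orbit π x y) πτ) ≐ Orbit π (π ⟨$⟩ʳ y) (π ⟨$⟩ʳ x)
  πτ-Orbit {x} {y} p = into , back
    where
    into : ((π , Orbit π x y) πτ) p → Orbit π (π ⟨$⟩ʳ y) (π ⟨$⟩ʳ x) p
    into (_ , (k , refl) , refl) = k , cong₂ _,_ (^-comm (2 * k) 1 y) (^-comm (2 * k) 1 x)
    back : Orbit π (π ⟨$⟩ʳ y) (π ⟨$⟩ʳ x) p → ((π , Orbit π x y) πτ) p
    back (k , refl) = _ , (k , refl) , cong₂ _,_ (^-comm 1 (2 * k) y) (^-comm 1 (2 * k) x)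

  Swapped : Fin n → Fin n → Set
  Swapped x y = Orbit π x y (π ⟨$⟩ʳ y , π ⟨$⟩ʳ x)

  singular⇒swapped : ∀ {x y} → Singular π (Orbit π x y) → Swapped x y
  singular⇒swapped sing = proj₁ (sing _) (proj₂ (πτ-Orbit _) (0 , refl))

  swapped⇒singular : ∀ {N x y} → π ^[ suc N ] x ≡ x → π ^[ suc N ] y ≡ y →
                     Swapped x y → Singular π (Orbit π x y)
  swapped⇒singular {N} x-per y-per swap = ≐-trans πτ-Orbit (Orbit-member {N} x-per y-per swap)

  swapped⇒Cycle : ∀ {x y} → Swapped x y → Cycle π x y
  swapped⇒Cycle (zero , eq) = 1 , sym (,-injectiveʳ eq)
  swapped⇒Cycle {x} (suc k , eq) = 1 + 2 * k , π-injective (trans (^-cong x (sym (*-suc 2 k))) (,-injectiveˡ eq))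

  singular⇒Cycle : ∀ {x y} → Singular π (Orbit π x y) → Cycle π x y
  singular⇒Cycle sing = swapped⇒Cycle (singular⇒swapped sing)

  swapped⇒^[2*d]≡id : ∀ d {x} → Swapped x (π ^[ d ] x) → π ^[ 2 * d ] x ≡ x
  swapped⇒^[2*d]≡id d {x} (k , eq) = sym (π-injective (begin
    π ⟨$⟩ʳ x                    ≡⟨ ,-injectiveʳ eq ⟨
    π ^[ 2 * k ] (π ^[ d ] x)   ≡⟨ ^-comm (2 * k) d x ⟩
    π ^[ d ] (π ^[ 2 * k ] x)   ≡⟨ cong (π ^[ d ]_) (,-injectiveˡ eq) ⟩
    π ^[ d ] (π ^[ 1 + d ] x)   ≡⟨ ^-+ d (1 + d) x ⟨
    π ^[ d + (1 + d) ] x        ≡⟨ ^-cong x (exponent d) ⟩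
    π ^[ 1 + 2 * d ] x          ∎))
    where
    open ≡-Reasoning
    exponent : ∀ d → d + (1 + d) ≡ 1 + 2 * d
    exponent = solve-∀

  swapped⇒odd : ∀ d {x L} → CycleLength π x L → 2 ∣ L → Swapped x (π ^[ d ] x) → d % 2 ≡ 1
  swapped⇒odd d cl 2∣L (k , eq) =
    %-pred-≡0 {d} (trans (sym (^-≡⇒%-≡ {a = 2 * k} {1 + d} cl 2∣L (,-injectiveˡ eq))) (2*n%2≡0 k))

  odd-^-even : ∀ h {x} → π ^[ 1 + 2 * h ] x ≡ x → ∀ t → π ^[ 2 * (t * suc h) ] x ≡ π ^[ t ] x
  odd-^-even h {x} per t = trans (^-cong x (exponent t h)) (^-periodic per t t)
    where
    exponent : ∀ t h → 2 * (t * suc h) ≡ t + t * (1 + 2 * h)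
    exponent = solve-∀

  odd-^-half : ∀ h d {x} → π ^[ 1 + 2 * h ] x ≡ x → π ^[ 2 * d ] x ≡ x → π ^[ d ] x ≡ x
  odd-^-half h d {x} per 2d-per = begin
    π ^[ d ] x                    ≡⟨ odd-^-even h per d ⟨
    π ^[ 2 * (d * suc h) ] x      ≡⟨ ^-cong x (exponent d h) ⟩
    π ^[ suc h * (2 * d) ] x      ≡⟨ ^-*-fixed {2 * d} 2d-per (suc h) ⟩
    x                             ∎
    where
    open ≡-Reasoning
    exponent : ∀ d h → 2 * (d * suc h) ≡ suc h * (2 * d)
    exponent = solve-∀

  odd-diagonal : ∀ h {c x} → π ^[ 1 + 2 * h ] c ≡ c → Cycle π c x → Orbit π x x ≐ Diag (Cycle π c)
  odd-diagonal h {c} {x} per x∈C (z , z′) = into , back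
    where
    into : Orbit π x x (z , z′) → Diag (Cycle π c) (z , z′)
    into (k , refl) = Cycle-^ x∈C (2 * k) , refl
    back : Diag (Cycle π c) (z , z′) → Orbit π x x (z , z′)
    back (z∈C , refl) with Cycle-reach {2 * h} per x∈C z∈C
    ... | t , refl = t * suc h , cong₂ _,_ t-even t-even
      where t-even = odd-^-even h (Cycle-periodic {1 + 2 * h} per x∈C) t

  odd-diagonal-singular : ∀ h {x} → π ^[ 1 + 2 * h ] x ≡ x → Singular π (Orbit π x x)
  odd-diagonal-singular h {x} per = swapped⇒singular {2 * h} per per (suc h , cong₂ _,_ step step)
    where
    step : π ^[ 2 * suc h ] x ≡ π ⟨$⟩ʳ x
    step = trans (^-cong x (*-suc 2 h)) (cong (π ⟨$⟩ʳ_) per)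

  half-turn : ∀ d {x M} → CycleLength π x (2 * M) → π ^[ 2 * d ] x ≡ x → d % 2 ≡ 1 →
              π ^[ d ] x ≡ π ^[ M ] x
  half-turn d {x} {M} cl@(_ , per , _) 2d-per d-odd with *-cancelˡ-∣ {M} {d} 2 (cycleLength-∣ cl 2d-per)
  ... | divides q refl with n%2≡1⇒odd {q} (∣-odd⇒odd {q} {q * M} (m∣m*n M) d-odd)
  ...   | h , refl = trans (^-cong x (exponent h M)) (^-periodic per M h)
    where
    exponent : ∀ h M → (1 + 2 * h) * M ≡ M + h * (2 * M)
    exponent = solve-∀

  half-turn-singular : ∀ m {x} → π ^[ 2 * (1 + 2 * m) ] x ≡ x →
                       Singular π (Orbit π x (π ^[ 1 + 2 * m ] x))
  half-turn-singular m {x} per =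
    swapped⇒singular {pred (2 * M)} per (Cycle-periodic {2 * M} per (M , refl)) (suc m , cong₂ _,_ there back)
    where
    M = 1 + 2 * m
    there : π ^[ 2 * suc m ] x ≡ π ^[ 1 + M ] x
    there = ^-cong x (*-suc 2 m)
    back : π ^[ 2 * suc m ] (π ^[ M ] x) ≡ π ⟨$⟩ʳ x
    back = begin
      π ^[ 2 * suc m ] (π ^[ M ] x) ≡⟨ ^-+ (2 * suc m) M x ⟨
      π ^[ 2 * suc m + M ] x        ≡⟨ ^-cong x (exponent m) ⟩
      π ^[ 1 + 2 * M ] x            ≡⟨ cong (π ⟨$⟩ʳ_) per ⟩
      π ⟨$⟩ʳ x                      ∎
      where
      open ≡-Reasoning
      exponent : ∀ m → 2 * suc m + (1 + 2 * m) ≡ 1 + 2 * (1 + 2 * m)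
      exponent = solve-∀

  even-cycle-^-odd : ∀ {c L} → CycleLength π c L → 2 ∣ L → ∀ k → π ^[ 1 + 2 * k ] c ≢ c
  even-cycle-^-odd cl 2∣L k eq =
    1+n≢0 (trans (sym ([1+2*n]%2≡1 k)) (^-≡⇒%-≡ {a = 1 + 2 * k} {0} cl 2∣L eq))

  swapped⇒odd⊎2mod4 : ∀ d {x L} → CycleLength π x L → Swapped x (π ^[ d ] x) →
                      L % 2 ≡ 1 ⊎ L % 4 ≡ 2
  swapped⇒odd⊎2mod4 d {L = L} cl swap with evenOdd L
  ... | odd h = inj₁ ([1+2*n]%2≡1 h)
  ... | even M with n%2≡1⇒odd {M} (∣-odd⇒odd M∣d (swapped⇒odd d cl (m∣m*n M) swap))
    where
    M∣d : M ∣ d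
    M∣d = *-cancelˡ-∣ 2 (cycleLength-∣ cl (swapped⇒^[2*d]≡id d swap))
  ...   | r , refl = inj₂ (2*[1+2*n]%4≡2 r)

  odd-cycle-singular-orbits : (c : Fin n) (L : ℕ) → CycleLength π c L → L % 2 ≡ 1 →
      (Singular π (Orbit π c c) × Orbit π c c ≐ Diag (Cycle π c))
      × ((x y : Fin n) → Orbit π x y ⊆Sq Cycle π c → Singular π (Orbit π x y) →
          Orbit π x y ≐ Diag (Cycle π c))
  odd-cycle-singular-orbits c L (_ , per , _) L-odd with n%2≡1⇒odd {L} L-odd
  ... | h , refl = (odd-diagonal-singular h per , odd-diagonal h per (0 , refl)) , unique
    where
    unique : (x y : Fin n) → Orbit π x y ⊆Sq Cycle π c → Singular π (Orbit π x y) →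
             Orbit π x y ≐ Diag (Cycle π c)
    unique x y sub sing with singular⇒Cycle sing
    ... | d , refl =
      subst (λ z → Orbit π x z ≐ Diag (Cycle π c)) (sym x-fixed) (odd-diagonal h per x∈C)
      where
      x∈C = proj₁ (sub (x , _) (0 , refl))
      x-fixed = odd-^-half h d (Cycle-periodic {1 + 2 * h} per x∈C)
                           (swapped⇒^[2*d]≡id d (singular⇒swapped sing))

  twice-odd-cycle-singular-orbits : (c : Fin n) (L : ℕ) → CycleLength π c L → L % 4 ≡ 2 →
      ∃ λ a → ∃ λ b → ∃ λ a′ → ∃ λ b′ →
        (Orbit π a b ⊆Sq Cycle π c × Singular π (Orbit π a b))
        × (Orbit π a′ b′ ⊆Sq Cycle π c × Singular π (Orbit π a′ b′))
        × ¬ (Orbit π a b ≐ Orbit π a′ b′)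
        × ((x y : Fin n) → Orbit π x y ⊆Sq Cycle π c → Singular π (Orbit π x y) →
            (Orbit π x y ≐ Orbit π a b) ⊎ (Orbit π x y ≐ Orbit π a′ b′))
  twice-odd-cycle-singular-orbits c L cl@(_ , per , _) L%4≡2 with n%4≡2⇒2*odd {L} L%4≡2
  ... | m , refl =
    c , π ^[ M ] c , π ⟨$⟩ʳ c , π ^[ M ] (π ⟨$⟩ʳ c) ,
    (Orbit-⊆Sq (0 , refl) (M , refl) , half-turn-singular m per) ,
    (Orbit-⊆Sq (1 , refl) (M + 1 , ^-+ M 1 c) , half-turn-singular m πc-per) ,
    distinct , unique
    where
    M = 1 + 2 * m
    πc-per = Cycle-periodic {2 * M} per (1 , refl)
    2∣L : 2 ∣ 2 * M
    2∣L = m∣m*n M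

    distinct : ¬ (Orbit π c (π ^[ M ] c) ≐ Orbit π (π ⟨$⟩ʳ c) (π ^[ M ] (π ⟨$⟩ʳ c)))
    distinct eq with proj₁ (eq _) (0 , refl)
    ... | k , e = even-cycle-^-odd cl 2∣L k (trans (^-comm 1 (2 * k) c) (,-injectiveˡ e))

    representative : ∀ {w x} g → π ^[ 2 * M ] w ≡ w → π ^[ 2 * g ] w ≡ x →
                     Orbit π x (π ^[ M ] x) ≐ Orbit π w (π ^[ M ] w)
    representative {w} g w-per refl =
      Orbit-member {pred (2 * M)} w-per (Cycle-periodic {2 * M} w-per (M , refl))
                   (g , cong (π ^[ 2 * g ] w ,_) (^-comm (2 * g) M w))

    classify : ∀ i {y} → y ≡ π ^[ M ] (π ^[ i ] c) →
               (Orbit π (π ^[ i ] c) y ≐ Orbit π c (π ^[ M ] c))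
               ⊎ (Orbit π (π ^[ i ] c) y ≐ Orbit π (π ⟨$⟩ʳ c) (π ^[ M ] (π ⟨$⟩ʳ c)))
    classify i refl with evenOdd i
    ... | even g = inj₁ (representative g per refl)
    ... | odd g = inj₂ (representative g πc-per (^-comm (2 * g) 1 c))

    unique : (x y : Fin n) → Orbit π x y ⊆Sq Cycle π c → Singular π (Orbit π x y) →
             (Orbit π x y ≐ Orbit π c (π ^[ M ] c)) ⊎ (Orbit π x y ≐ Orbit π (π ⟨$⟩ʳ c) (π ^[ M ] (π ⟨$⟩ʳ c)))
    unique x y sub sing with proj₁ (sub (x , y) (0 , refl)) | singular⇒Cycle sing
    ... | x∈C@(i , refl) | d , refl =
      classify i (half-turn d x-cl (swapped⇒^[2*d]≡id d swap) (swapped⇒odd d x-cl 2∣L swap))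
      where
      x-cl = CycleLength-member cl x∈C
      swap = singular⇒swapped sing

  singular-orbit-cycle : (x y : Fin n) → Singular π (Orbit π x y) →
      ∃ λ c → ∃ λ L → CycleLength π c L × Orbit π x y ⊆Sq Cycle π c × (L % 2 ≡ 1 ⊎ L % 4 ≡ 2)
  singular-orbit-cycle x y sing with singular⇒Cycle sing | cycleLength-exists x
  ... | d , refl | L , cl =
    x , L , cl , Orbit-⊆Sq (0 , refl) (d , refl) , swapped⇒odd⊎2mod4 d cl (singular⇒swapped sing)

proposition8p2 : (n : ℕ) (π : Permutation′ n) →
    ((c : Fin n) (L : ℕ) → CycleLength π c L → L % 2 ≡ 1 →
      (Singular π (Orbit π c c) × Orbit π c c ≐ Diag (Cycle π c))
      × ((x y : Fin n) → Orbit π x y ⊆Sq Cycle π c → Singular π (Orbit π x y) →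
          Orbit π x y ≐ Diag (Cycle π c)))
    × ((c : Fin n) (L : ℕ) → CycleLength π c L → L % 4 ≡ 2 →
      ∃ λ a → ∃ λ b → ∃ λ a′ → ∃ λ b′ →
        (Orbit π a b ⊆Sq Cycle π c × Singular π (Orbit π a b))
        × (Orbit π a′ b′ ⊆Sq Cycle π c × Singular π (Orbit π a′ b′))
        × ¬ (Orbit π a b ≐ Orbit π a′ b′)
        × ((x y : Fin n) → Orbit π x y ⊆Sq Cycle π c → Singular π (Orbit π x y) →
            (Orbit π x y ≐ Orbit π a b) ⊎ (Orbit π x y ≐ Orbit π a′ b′)))
    × ((x y : Fin n) → Singular π (Orbit π x y) →
      ∃ λ c → ∃ λ L → CycleLength π c L × Orbit π x y ⊆Sq Cycle π c
        × (L % 2 ≡ 1 ⊎ L % 4 ≡ 2))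
proposition8p2 n π = odd-cycle-singular-orbits , twice-odd-cycle-singular-orbits , singular-orbit-cycle
  where open Cycles π
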